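{- Let $n>2$ be an integer, let $\sigma\in C_n$, and let $k$ be a positive integer with $k\cdot\mathrm{ord}(\sigma)=n$. Then $$S_\sigma:=\sum_{x\in\mathbb{F}_2^n}(-1)^{x\cdot\sigma x}=\begin{cases}2^{\frac n2+\frac{n}{\mathrm{ord}(\sigma)}} & \text{if } \mathrm{ord}(\sigma)\text{ is even},\\ 0 & \text{if }\mathrm{ord}(\sigma)\text{ is odd}.\end{cases}$$
   Context: For $x,y\in\mathbb{F}_2^n$, $x\cdot y=\sum_{i=1}^n x_iy_i\in\mathbb{F}_2$, and $(-1)^{a}$ for $a\in\mathbb{F}_2$ means $1$ if $a=0$ and $-1$ if $a=1$. $\rho_n:\mathbb{F}_2^n\to\mathbb{F}_2^n$ is the cyclic shift $\rho_n(x_1,x_2,\dots,x_n)=(x_2,\dots,x_n,x_1)$, and $C_n=\langle\rho_n\rangle$ is the cyclic group it generates (acting on $\mathbb{F}_2^n$); $\mathrm{ord}(\sigma)$ is the order of $\sigma$ in this group. -}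

module Defs where

open import Data.Nat using (ℕ; zero; suc; _<_)
open import Data.Bool using (Bool; true; false; _∧_; _xor_)
open import Data.Vec using (Vec; []; _∷_; _∷ʳ_; foldr; zipWith)
open import Data.List using (List; map; _++_; [_])
import Data.List as L
open import Data.Integer using (ℤ; +_; -_)
import Data.Integer as ℤ
open import Data.Product using (_×_)
open import Relation.Nullary using (¬_)
open import Relation.Binary.PropositionalEquality using (_≡_)

-- F₂ is Bool (false = 0, true = 1); F₂^n is Vec Bool n.

ρ : ∀ {n} → Vec Bool n → Vec Bool n
ρ []       = []
ρ (x ∷ xs) = xs ∷ʳ x

_^[_] : ∀ {A : Set} → (A → A) → ℕ → A → A
(f ^[ zero  ]) a = a
(f ^[ suc j ]) a = f ((f ^[ j ]) a)

_·_ : ∀ {n} → Vec Bool n → Vec Bool n → Bool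
x · y = foldr (λ _ → Bool) _xor_ false (zipWith _∧_ x y)

sgn : Bool → ℤ
sgn false = + 1
sgn true  = - (+ 1)

allVecs : (n : ℕ) → List (Vec Bool n)
allVecs zero    = [ [] ]
allVecs (suc n) = map (false ∷_) (allVecs n) ++ map (true ∷_) (allVecs n)

sumF2 : (n : ℕ) → (Vec Bool n → ℤ) → ℤ
sumF2 n f = L.foldr ℤ._+_ (+ 0) (map f (allVecs n))

S : (n : ℕ) → (Vec Bool n → Vec Bool n) → ℤ
S n σ = sumF2 n (λ x → sgn (x · σ x))

IsId : ∀ {n} → (Vec Bool n → Vec Bool n) → Set
IsId {n} τ = ∀ (x : Vec Bool n) → τ x ≡ x

IsOrder : ∀ {n} → (Vec Bool n → Vec Bool n) → ℕ → Set
IsOrder σ m = (0 < m) × IsId (σ ^[ m ]) × (∀ m′ → 0 < m′ → m′ < m → ¬ IsId (σ ^[ m′ ]))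

{-# OPTIONS --safe #-}
-- Write σ = ρʲ and n = k·m with m = ord σ, so that x · σx = Σᵢ xᵢ x_{i+j} (indices mod n).
-- The index map r·m + t ↦ r + t·j (r < k, t < m) runs through the orbits of i ↦ i + j one
-- after another; it is injective because k ∣ j recovers r as the residue mod k, and the
-- minimality of m then recovers t.  Permuting coordinates along it turns x · σx into k copies
-- of the cyclic form u · ρu on F₂ᵐ in disjoint variables, so S_σ = Tₘᵏ with
-- Tₘ = Σ_u (−1)^{u·ρu}.  Summing out the second and third coordinates of u gives
-- T_{m+3} = 2 T_{m+1}; with T₁ = 0 and T₂ = 4 this gives Tₘ = 0 for odd m and T_{2q} = 2^{q+1}.
module Submission where

open import Defs
open import Data.Nat using (ℕ; zero; suc; _<_; _≤_; z≤n; s≤s; _+_; _*_; _^_; _∸_; NonZero)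
import Data.Nat.Properties as ℕ
open import Data.Nat.DivMod
open import Data.Nat.Divisibility
  using (_∣_; divides; _∣0; ∣-refl; ∣m∣n⇒∣m+n; ∣n⇒∣m*n; n∣m*n; m∣m*n; *-cancelʳ-∣;
         m%n≡0⇒n∣m)
open import Data.Nat.Tactic.RingSolver using (solve-∀)
open import Data.Bool using (Bool; true; false; _∧_; _xor_)
open import Data.Bool.Properties using (xor-assoc; xor-∧-commutativeRing)
open import Data.Fin using (Fin; toℕ; fromℕ<; punchOut)
import Data.Fin.Properties as Fin
open import Data.Fin.Permutation using (Permutation′; permutation; _⟨$⟩ʳ_; _⟨$⟩ˡ_; inverseˡ; inverseʳ)
open import Data.Vec using (Vec; []; _∷_; _∷ʳ_; _++_; lookup; tabulate; replicate)
open import Data.Vec.Properties using (lookup∘tabulate; tabulate∘lookup; tabulate-cong)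
open import Data.List using (List; map; foldr; allFin)
import Data.List as List
open import Data.List.Properties using (map-∘; map-cong; map-tabulate)
open import Data.List.Relation.Unary.All using ([])
import Data.List.Relation.Unary.AllPairs as AllPairs
open import Data.List.Relation.Unary.Any using (here)
open import Data.List.Relation.Unary.Unique.Propositional using (Unique)
import Data.List.Relation.Unary.Unique.Propositional.Properties as Unique
open import Data.List.Membership.Propositional using (_∈_)
open import Data.List.Membership.Propositional.Properties using (∈-map⁺; ∈-map⁻; ∈-++⁺ˡ; ∈-++⁺ʳ; ∈-allFin)
open import Data.List.Membership.Propositional.Properties.WithK using (unique∧set⇒bag)
open import Data.List.Relation.Binary.BagAndSetEquality using (∼bag⇒↭)
open import Data.List.Relation.Binary.Permutation.Propositional using (_↭_; ↭⇒↭ₛ)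
import Data.List.Relation.Binary.Permutation.Propositional.Properties as ↭
open import Data.List.Relation.Binary.Permutation.Setoid.Properties using (foldr-commMonoid)
open import Data.Integer using (ℤ; +_)
import Data.Integer as ℤ
import Data.Integer.Properties as ℤ
open import Data.Product using (∃; _×_; _,_; proj₁; proj₂)
open import Data.Sum using (inj₁; inj₂)
open import Data.Empty using (⊥)
open import Algebra.Structures using (IsCommutativeMonoid)
open import Algebra.Properties.CommutativeSemigroup ℤ.+-commutativeSemigroup using () renaming (interchange to +-interchange)
open import Algebra.Bundles using (CommutativeRing)
open import Function using (_∘_; mk⇔)
open import Function.Definitions using (Injective)
open import Relation.Nullary using (¬_; yes; no; contradiction)
open import Relation.Binary.PropositionalEquality

module _ {A : Set} {_∙_ : A → A → A} {ε : A} (isCM : IsCommutativeMonoid _≡_ _∙_ ε) where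

  foldr-map-inverse : ∀ {B : Set} {xs : List B} → Unique xs → (∀ b → b ∈ xs) →
                      (f g : B → B) → (∀ b → f (g b) ≡ b) → (∀ b → g (f b) ≡ b) →
                      (F : B → A) → foldr _∙_ ε (map (F ∘ f) xs) ≡ foldr _∙_ ε (map F xs)
  foldr-map-inverse {xs = xs} unique complete f g fg gf F = begin
    foldr _∙_ ε (map (F ∘ f) xs)   ≡⟨ cong (foldr _∙_ ε) (map-∘ xs) ⟩
    foldr _∙_ ε (map F (map f xs)) ≡⟨ foldr-commMonoid (setoid A) isCM (↭⇒↭ₛ (↭.map⁺ F map-f↭id)) ⟩
    foldr _∙_ ε (map F xs)         ∎
    where
    open ≡-Reasoning
    f-injective : ∀ {a b} → f a ≡ f b → a ≡ b
    f-injective {a} {b} eq = trans (sym (gf a)) (trans (cong g eq) (gf b))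
    f-onto : ∀ b → b ∈ map f xs
    f-onto b = subst (_∈ map f xs) (fg b) (∈-map⁺ f (complete (g b)))
    map-f↭id : map f xs ↭ xs
    map-f↭id = ∼bag⇒↭ (unique∧set⇒bag (Unique.map⁺ f-injective unique) unique
                                        (mk⇔ (λ _ → complete _) (λ _ → f-onto _)))

injective⇒surjective : ∀ {n} {f : Fin n → Fin n} → Injective _≡_ _≡_ f → ∀ y → ∃ λ x → f x ≡ y
injective⇒surjective {f = f} f-injective y with Fin.any? (λ x → f x Fin.≟ y)
... | yes found = found
injective⇒surjective {suc n} {f} f-injective y | no missed =
  contradiction (Fin.injective⇒≤ avoiding-injective) (ℕ.<-irrefl refl)
  where
  f-avoiding-y : Fin (suc n) → Fin n
  f-avoiding-y x = punchOut {i = y} (λ eq → missed (x , sym eq))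
  avoiding-injective : Injective _≡_ _≡_ f-avoiding-y
  avoiding-injective {a} {b} eq =
    f-injective (Fin.punchOut-injective (λ e → missed (a , sym e)) (λ e → missed (b , sym e)) eq)

injective⇒permutation : ∀ {n} (f : Fin n → Fin n) → Injective _≡_ _≡_ f → Permutation′ n
injective⇒permutation f f-injective =
  permutation f (proj₁ ∘ onto) (proj₂ ∘ onto) (λ x → f-injective (proj₂ (onto (f x))))
  where
  onto : ∀ y → ∃ λ x → f x ≡ y
  onto = injective⇒surjective f-injective

reindex : ∀ {A : Set} {n} → (Fin n → Fin n) → Vec A n → Vec A n
reindex f x = tabulate (lookup x ∘ f)

reindex-inverse : ∀ {A : Set} {n} {f g : Fin n → Fin n} → (∀ i → f (g i) ≡ i) →
                  ∀ (x : Vec A n) → reindex g (reindex f x) ≡ x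
reindex-inverse {f = f} {g} fg x = begin
  tabulate (lookup (tabulate (lookup x ∘ f)) ∘ g) ≡⟨ tabulate-cong (lookup∘tabulate (lookup x ∘ f) ∘ g) ⟩
  tabulate (lookup x ∘ f ∘ g)                     ≡⟨ tabulate-cong (cong (lookup x) ∘ fg) ⟩
  tabulate (lookup x)                             ≡⟨ tabulate∘lookup x ⟩
  x                                               ∎
  where open ≡-Reasoning

-- Indexing by ℕ; out-of-range indices read false.
infixl 9 _‼_
_‼_ : ∀ {n} → Vec Bool n → ℕ → Bool
[]       ‼ _     = false
(a ∷ _)  ‼ zero  = a
(_ ∷ xs) ‼ suc i = xs ‼ i

‼-toℕ : ∀ {n} (x : Vec Bool n) (i : Fin n) → x ‼ toℕ i ≡ lookup x i
‼-toℕ (a ∷ _)  Fin.zero    = refl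
‼-toℕ (_ ∷ xs) (Fin.suc i) = ‼-toℕ xs i

‼-tabulate : ∀ {n} (f : Fin n → Bool) {i} (i<n : i < n) → tabulate f ‼ i ≡ f (fromℕ< i<n)
‼-tabulate f {i} i<n = begin
  tabulate f ‼ i                     ≡⟨ cong (tabulate f ‼_) (Fin.toℕ-fromℕ< i<n) ⟨
  tabulate f ‼ toℕ (fromℕ< i<n)      ≡⟨ ‼-toℕ (tabulate f) (fromℕ< i<n) ⟩
  lookup (tabulate f) (fromℕ< i<n)   ≡⟨ lookup∘tabulate f (fromℕ< i<n) ⟩
  f (fromℕ< i<n)                     ∎
  where open ≡-Reasoning

‼-extensionality : ∀ {n} {x y : Vec Bool n} → (∀ i → i < n → x ‼ i ≡ y ‼ i) → x ≡ y
‼-extensionality {x = []}    {[]}    _  = refl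
‼-extensionality {x = a ∷ x} {b ∷ y} eq =
  cong₂ _∷_ (eq 0 (s≤s z≤n)) (‼-extensionality (λ i i<n → eq (suc i) (s≤s i<n)))

‼-∷ʳ-< : ∀ {n} (xs : Vec Bool n) a {i} → i < n → (xs ∷ʳ a) ‼ i ≡ xs ‼ i
‼-∷ʳ-< (_ ∷ _)  a {zero}  _         = refl
‼-∷ʳ-< (_ ∷ xs) a {suc i} (s≤s i<n) = ‼-∷ʳ-< xs a i<n

‼-∷ʳ : ∀ {n} (xs : Vec Bool n) a → (xs ∷ʳ a) ‼ n ≡ a
‼-∷ʳ []       a = refl
‼-∷ʳ (_ ∷ xs) a = ‼-∷ʳ xs a

‼-++ˡ : ∀ {m n} (u : Vec Bool m) (v : Vec Bool n) {i} → i < m → (u ++ v) ‼ i ≡ u ‼ i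
‼-++ˡ (_ ∷ _) v {zero}  _         = refl
‼-++ˡ (_ ∷ u) v {suc i} (s≤s i<m) = ‼-++ˡ u v i<m

‼-++ʳ : ∀ {m n} (u : Vec Bool m) (v : Vec Bool n) i → (u ++ v) ‼ (m + i) ≡ v ‼ i
‼-++ʳ []      v i = refl
‼-++ʳ (_ ∷ u) v i = ‼-++ʳ u v i

‼-replicate : ∀ n i → replicate n false ‼ i ≡ false
‼-replicate zero    i       = refl
‼-replicate (suc n) zero    = refl
‼-replicate (suc n) (suc i) = ‼-replicate n i

‼-∷ʳ-rotate : ∀ {n} (xs : Vec Bool n) a {q} → q < suc n → (xs ∷ʳ a) ‼ q ≡ (a ∷ xs) ‼ (suc q % suc n)
‼-∷ʳ-rotate {n} xs a q<N with ℕ.m<1+n⇒m<n∨m≡n q<N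
... | inj₁ q<n  = trans (‼-∷ʳ-< xs a q<n) (cong ((a ∷ xs) ‼_) (sym (m<n⇒m%n≡m (s≤s q<n))))
... | inj₂ refl = trans (‼-∷ʳ xs a) (cong ((a ∷ xs) ‼_) (sym (n%n≡0 (suc n))))

[m+n%d]%d≡[m+n]%d : ∀ m n d .{{_ : NonZero d}} → (m + n % d) % d ≡ (m + n) % d
[m+n%d]%d≡[m+n]%d m n d = begin
  (m + n % d) % d           ≡⟨ %-distribˡ-+ m (n % d) d ⟩
  (m % d + n % d % d) % d   ≡⟨ cong (λ z → (m % d + z) % d) (m%n%n≡m%n n d) ⟩
  (m % d + n % d) % d       ≡⟨ %-distribˡ-+ m n d ⟨
  (m + n) % d               ∎
  where open ≡-Reasoning

[m%d+n]%d≡[m+n]%d : ∀ m n d .{{_ : NonZero d}} → (m % d + n) % d ≡ (m + n) % d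
[m%d+n]%d≡[m+n]%d m n d = begin
  (m % d + n) % d           ≡⟨ %-distribˡ-+ (m % d) n d ⟩
  (m % d % d + n % d) % d   ≡⟨ cong (λ z → (z + n % d) % d) (m%n%n≡m%n m d) ⟩
  (m % d + n % d) % d       ≡⟨ %-distribˡ-+ m n d ⟨
  (m + n) % d               ∎
  where open ≡-Reasoning

-- Adding c (n − 1) to both sides turns the c into a multiple of n.
%-cancelˡ-+ : ∀ c a b n .{{_ : NonZero n}} → (c + a) % n ≡ (c + b) % n → a % n ≡ b % n
%-cancelˡ-+ c a b n@(suc n-1) eq = begin
  a % n                                 ≡⟨ [m+kn]%n≡m%n a c n ⟨
  (a + c * n) % n                       ≡⟨ cong (_% n) (regroup a c n-1) ⟩
  (c + a + c * n-1) % n                 ≡⟨ %-distribˡ-+ (c + a) (c * n-1) n ⟩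
  ((c + a) % n + c * n-1 % n) % n       ≡⟨ cong (λ z → (z + c * n-1 % n) % n) eq ⟩
  ((c + b) % n + c * n-1 % n) % n       ≡⟨ %-distribˡ-+ (c + b) (c * n-1) n ⟨
  (c + b + c * n-1) % n                 ≡⟨ cong (_% n) (regroup b c n-1) ⟨
  (b + c * n) % n                       ≡⟨ [m+kn]%n≡m%n b c n ⟩
  b % n                                 ∎
  where
  open ≡-Reasoning
  regroup : ∀ x c n-1 → x + c * suc n-1 ≡ c + x + c * n-1
  regroup = solve-∀

_⟪_⟫ : ∀ {n} → Vec Bool (suc n) → ℕ → Bool
_⟪_⟫ {n} x i = x ‼ (i % suc n)

⟪⟫-< : ∀ {n} (x : Vec Bool (suc n)) {i} → i < suc n → x ⟪ i ⟫ ≡ x ‼ i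
⟪⟫-< x i<n = cong (x ‼_) (m<n⇒m%n≡m i<n)

⟪⟫-ρ : ∀ {n} (x : Vec Bool (suc n)) i → ρ x ⟪ i ⟫ ≡ x ⟪ suc i ⟫
⟪⟫-ρ {n} (a ∷ xs) i = trans (‼-∷ʳ-rotate xs a (m%n<n i (suc n)))
                            (cong ((a ∷ xs) ‼_) ([m+n%d]%d≡[m+n]%d 1 i (suc n)))

⟪⟫-ρ^ : ∀ {n} (x : Vec Bool (suc n)) s i → (ρ ^[ s ]) x ⟪ i ⟫ ≡ x ⟪ i + s ⟫
⟪⟫-ρ^ x zero    i = cong (x ⟪_⟫) (sym (ℕ.+-identityʳ i))
⟪⟫-ρ^ x (suc s) i = begin
  ρ ((ρ ^[ s ]) x) ⟪ i ⟫  ≡⟨ ⟪⟫-ρ ((ρ ^[ s ]) x) i ⟩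
  (ρ ^[ s ]) x ⟪ suc i ⟫  ≡⟨ ⟪⟫-ρ^ x s (suc i) ⟩
  x ⟪ suc i + s ⟫         ≡⟨ cong (x ⟪_⟫) (sym (ℕ.+-suc i s)) ⟩
  x ⟪ i + suc s ⟫         ∎
  where open ≡-Reasoning

^[]-+ : ∀ {A : Set} (f : A → A) m n a → (f ^[ m + n ]) a ≡ (f ^[ m ]) ((f ^[ n ]) a)
^[]-+ f zero    n a = refl
^[]-+ f (suc m) n a = cong f (^[]-+ f m n a)

^[]-* : ∀ {A : Set} (f : A → A) j t a → ((f ^[ j ]) ^[ t ]) a ≡ (f ^[ t * j ]) a
^[]-* f j zero    a = refl
^[]-* f j (suc t) a = trans (cong (f ^[ j ]) (^[]-* f j t a)) (sym (^[]-+ f j (t * j) a))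

ρ^-id⇒∣ : ∀ {n} s → IsId (ρ {suc n} ^[ s ]) → suc n ∣ s
ρ^-id⇒∣ {n} s ρ^s≡id = m%n≡0⇒n∣m s (suc n) (only-0-is-true (s % suc n) (begin
  e₀ ⟪ s ⟫               ≡⟨ ⟪⟫-ρ^ e₀ s 0 ⟨
  (ρ ^[ s ]) e₀ ⟪ 0 ⟫    ≡⟨ cong (_⟪ 0 ⟫) (ρ^s≡id e₀) ⟩
  true                   ∎))
  where
  open ≡-Reasoning
  e₀ : Vec Bool (suc n)
  e₀ = true ∷ replicate n false
  only-0-is-true : ∀ q → e₀ ‼ q ≡ true → q ≡ 0
  only-0-is-true zero    _  = refl
  only-0-is-true (suc q) eq with trans (sym (‼-replicate n q)) eq
  ... | ()

∣⇒ρ^-id : ∀ {n} s → suc n ∣ s → IsId (ρ {suc n} ^[ s ])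
∣⇒ρ^-id {n} s N∣s x = ‼-extensionality λ i i<N → begin
  (ρ ^[ s ]) x ‼ i      ≡⟨ ⟪⟫-< ((ρ ^[ s ]) x) i<N ⟨
  (ρ ^[ s ]) x ⟪ i ⟫    ≡⟨ ⟪⟫-ρ^ x s i ⟩
  x ⟪ i + s ⟫           ≡⟨ cong (x ‼_) (%-remove-+ʳ i N∣s) ⟩
  x ⟪ i ⟫               ≡⟨ ⟪⟫-< x i<N ⟩
  x ‼ i                 ∎
  where open ≡-Reasoning

xorSum : ℕ → (ℕ → Bool) → Bool
xorSum zero    h = false
xorSum (suc n) h = h 0 xor xorSum n (h ∘ suc)

syntax xorSum n (λ i → e) = ⨁[ i < n ] e

xorSum-cong : ∀ n {f g : ℕ → Bool} → (∀ i → i < n → f i ≡ g i) → xorSum n f ≡ xorSum n g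
xorSum-cong zero    eq = refl
xorSum-cong (suc n) eq = cong₂ _xor_ (eq 0 (s≤s z≤n)) (xorSum-cong n (λ i i<n → eq (suc i) (s≤s i<n)))

xorSum-+ : ∀ m n (h : ℕ → Bool) → xorSum (m + n) h ≡ xorSum m h xor ⨁[ i < n ] h (m + i)
xorSum-+ zero    n h = refl
xorSum-+ (suc m) n h = trans (cong (h 0 xor_) (xorSum-+ m n (h ∘ suc))) (sym (xor-assoc (h 0) _ _))

xorSum-* : ∀ k m (h : ℕ → Bool) → xorSum (k * m) h ≡ ⨁[ r < k ] ⨁[ t < m ] h (r * m + t)
xorSum-* zero    m h = refl
xorSum-* (suc k) m h = begin
  xorSum (m + k * m) h
    ≡⟨ xorSum-+ m (k * m) h ⟩
  xorSum m h xor xorSum (k * m) (λ i → h (m + i))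
    ≡⟨ cong (xorSum m h xor_) (xorSum-* k m (λ i → h (m + i))) ⟩
  xorSum m h xor (⨁[ r < k ] ⨁[ t < m ] h (m + (r * m + t)))
    ≡⟨ cong (xorSum m h xor_) (xorSum-cong k (λ r _ → xorSum-cong m (λ t _ →
         cong h (sym (ℕ.+-assoc m (r * m) t))))) ⟩
  xorSum m h xor (⨁[ r < k ] ⨁[ t < m ] h (m + r * m + t))
    ∎
  where open ≡-Reasoning

xorSum-as-foldr : ∀ n (h : ℕ → Bool) → xorSum n h ≡ foldr _xor_ false (map (h ∘ toℕ) (allFin n))
xorSum-as-foldr n h = trans (tabulated n h) (cong (foldr _xor_ false) (sym (map-tabulate {n = n} (λ i → i) (h ∘ toℕ))))
  where
  tabulated : ∀ n (h : ℕ → Bool) → xorSum n h ≡ foldr _xor_ false (List.tabulate (h ∘ toℕ {n}))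
  tabulated zero    h = refl
  tabulated (suc n) h = cong (h 0 xor_) (tabulated n (h ∘ suc))

xorSum-permute : ∀ n (π : Permutation′ n) (ψ : ℕ → ℕ) → (∀ p → toℕ (π ⟨$⟩ʳ p) ≡ ψ (toℕ p)) →
                 ∀ (h : ℕ → Bool) → ⨁[ p < n ] h (ψ p) ≡ xorSum n h
xorSum-permute n π ψ π≗ψ h = begin
  xorSum n (h ∘ ψ)                                        ≡⟨ xorSum-as-foldr n (h ∘ ψ) ⟩
  foldr _xor_ false (map (h ∘ ψ ∘ toℕ) (allFin n))        ≡⟨ cong (foldr _xor_ false) (map-cong (cong h ∘ sym ∘ π≗ψ) (allFin n)) ⟩
  foldr _xor_ false (map (h ∘ toℕ ∘ (π ⟨$⟩ʳ_)) (allFin n)) ≡⟨ foldr-map-inverse xor-isCommutativeMonoid (Unique.allFin⁺ n) ∈-allFin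
                                                               (π ⟨$⟩ʳ_) (π ⟨$⟩ˡ_) (λ _ → inverseʳ π) (λ _ → inverseˡ π) (h ∘ toℕ) ⟩
  foldr _xor_ false (map (h ∘ toℕ) (allFin n))            ≡⟨ xorSum-as-foldr n h ⟨
  xorSum n h                                              ∎
  where
  open ≡-Reasoning
  xor-isCommutativeMonoid : IsCommutativeMonoid _≡_ _xor_ false
  xor-isCommutativeMonoid = CommutativeRing.+-isCommutativeMonoid xor-∧-commutativeRing

·-as-xorSum : ∀ {n} (x y : Vec Bool n) → x · y ≡ ⨁[ i < n ] (x ‼ i ∧ y ‼ i)
·-as-xorSum []      []      = refl
·-as-xorSum (a ∷ x) (b ∷ y) = cong ((a ∧ b) xor_) (·-as-xorSum x y)

·ρ^-as-xorSum : ∀ {n} (x : Vec Bool (suc n)) s → x · (ρ ^[ s ]) x ≡ ⨁[ i < suc n ] (x ⟪ i ⟫ ∧ x ⟪ i + s ⟫)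
·ρ^-as-xorSum {n} x s = trans (·-as-xorSum x ((ρ ^[ s ]) x)) (xorSum-cong (suc n) (λ i i<N →
  cong₂ _∧_ (sym (⟪⟫-< x i<N)) (trans (sym (⟪⟫-< ((ρ ^[ s ]) x) i<N)) (⟪⟫-ρ^ x s i))))

module _ {B : Set} where

  ∑ : List B → (B → ℤ) → ℤ
  ∑ xs F = foldr ℤ._+_ (+ 0) (map F xs)

  ∑-++ : ∀ xs ys (F : B → ℤ) → ∑ (xs List.++ ys) F ≡ ∑ xs F ℤ.+ ∑ ys F
  ∑-++ List.[]       ys F = sym (ℤ.+-identityˡ _)
  ∑-++ (x List.∷ xs) ys F = trans (cong (λ s → F x ℤ.+ s) (∑-++ xs ys F)) (sym (ℤ.+-assoc (F x) _ _))

  ∑-cong : ∀ xs {F G : B → ℤ} → (∀ x → F x ≡ G x) → ∑ xs F ≡ ∑ xs G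
  ∑-cong xs eq = cong (foldr ℤ._+_ (+ 0)) (map-cong eq xs)

  ∑-+ : ∀ xs (F G : B → ℤ) → ∑ xs (λ x → F x ℤ.+ G x) ≡ ∑ xs F ℤ.+ ∑ xs G
  ∑-+ List.[]       F G = refl
  ∑-+ (x List.∷ xs) F G =
    trans (cong (λ s → (F x ℤ.+ G x) ℤ.+ s) (∑-+ xs F G)) (+-interchange (F x) (G x) _ _)

  ∑-*ˡ : ∀ xs (F : B → ℤ) c → ∑ xs (λ x → c ℤ.* F x) ≡ c ℤ.* ∑ xs F
  ∑-*ˡ List.[]       F c = sym (ℤ.*-zeroʳ c)
  ∑-*ˡ (x List.∷ xs) F c = trans (cong (λ s → c ℤ.* F x ℤ.+ s) (∑-*ˡ xs F c)) (sym (ℤ.*-distribˡ-+ c (F x) _))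

  ∑-*ʳ : ∀ xs (F : B → ℤ) c → ∑ xs (λ x → F x ℤ.* c) ≡ ∑ xs F ℤ.* c
  ∑-*ʳ List.[]       F c = sym (ℤ.*-zeroˡ c)
  ∑-*ʳ (x List.∷ xs) F c = trans (cong (λ s → F x ℤ.* c ℤ.+ s) (∑-*ʳ xs F c)) (sym (ℤ.*-distribʳ-+ c (F x) _))

sumF2-∷ : ∀ n (F : Vec Bool (suc n) → ℤ) →
          sumF2 (suc n) F ≡ sumF2 n (λ x → F (false ∷ x)) ℤ.+ sumF2 n (λ x → F (true ∷ x))
sumF2-∷ n F = trans (∑-++ (map (false ∷_) (allVecs n)) (map (true ∷_) (allVecs n)) F)
                    (cong₂ ℤ._+_ (cong (foldr ℤ._+_ (+ 0)) (sym (map-∘ (allVecs n))))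
                                 (cong (foldr ℤ._+_ (+ 0)) (sym (map-∘ (allVecs n)))))

sumF2-cong : ∀ n {F G : Vec Bool n → ℤ} → (∀ x → F x ≡ G x) → sumF2 n F ≡ sumF2 n G
sumF2-cong n = ∑-cong (allVecs n)

sumF2-++ : ∀ m n (F : Vec Bool (m + n) → ℤ) → sumF2 (m + n) F ≡ sumF2 m (λ u → sumF2 n (λ v → F (u ++ v)))
sumF2-++ zero    n F = sym (ℤ.+-identityʳ _)
sumF2-++ (suc m) n F = begin
  sumF2 (suc m + n) F
    ≡⟨ sumF2-∷ (m + n) F ⟩
  sumF2 (m + n) (λ x → F (false ∷ x)) ℤ.+ sumF2 (m + n) (λ x → F (true ∷ x))
    ≡⟨ cong₂ ℤ._+_ (sumF2-++ m n (λ x → F (false ∷ x))) (sumF2-++ m n (λ x → F (true ∷ x))) ⟩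
  sumF2 m (λ u → sumF2 n (λ v → F (false ∷ u ++ v))) ℤ.+ sumF2 m (λ u → sumF2 n (λ v → F (true ∷ u ++ v)))
    ≡⟨ sumF2-∷ m _ ⟨
  sumF2 (suc m) (λ u → sumF2 n (λ v → F (u ++ v)))
    ∎
  where open ≡-Reasoning

allVecs-unique : ∀ n → Unique (allVecs n)
allVecs-unique zero    = [] AllPairs.∷ AllPairs.[]
allVecs-unique (suc n) =
  Unique.++⁺ (Unique.map⁺ ∷-injectiveʳ (allVecs-unique n)) (Unique.map⁺ ∷-injectiveʳ (allVecs-unique n)) disjoint
  where
  ∷-injectiveʳ : ∀ {b} {x y : Vec Bool n} → b ∷ x ≡ b ∷ y → x ≡ y
  ∷-injectiveʳ refl = refl
  disjoint : ∀ {v} → v ∈ map (false ∷_) (allVecs n) × v ∈ map (true ∷_) (allVecs n) → ⊥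
  disjoint (v∈f , v∈t) with ∈-map⁻ (false ∷_) v∈f | ∈-map⁻ (true ∷_) v∈t
  ... | _ , _ , refl | _ , _ , ()

allVecs-complete : ∀ n (x : Vec Bool n) → x ∈ allVecs n
allVecs-complete zero    []          = here refl
allVecs-complete (suc n) (false ∷ x) = ∈-++⁺ˡ (∈-map⁺ (false ∷_) (allVecs-complete n x))
allVecs-complete (suc n) (true ∷ x)  = ∈-++⁺ʳ (map (false ∷_) (allVecs n)) (∈-map⁺ (true ∷_) (allVecs-complete n x))

sumF2-reindex : ∀ n (π : Permutation′ n) (F : Vec Bool n → ℤ) → sumF2 n (F ∘ reindex (π ⟨$⟩ʳ_)) ≡ sumF2 n F
sumF2-reindex n π F = foldr-map-inverse ℤ.+-0-isCommutativeMonoid (allVecs-unique n) (allVecs-complete n)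
  (reindex (π ⟨$⟩ʳ_)) (reindex (π ⟨$⟩ˡ_)) (reindex-inverse (λ _ → inverseˡ π)) (reindex-inverse (λ _ → inverseʳ π)) F

sgn-xor : ∀ a b → sgn (a xor b) ≡ sgn a ℤ.* sgn b
sgn-xor false false = refl
sgn-xor false true  = refl
sgn-xor true  false = refl
sgn-xor true  true  = refl

sumF2-2+ : ∀ m (F : Vec Bool (2 + m) → ℤ) → sumF2 (2 + m) F ≡
  sumF2 m (λ r → (F (false ∷ false ∷ r) ℤ.+ F (false ∷ true ∷ r)) ℤ.+ (F (true ∷ false ∷ r) ℤ.+ F (true ∷ true ∷ r)))
sumF2-2+ m F = begin
  sumF2 (2 + m) F
    ≡⟨ sumF2-∷ (suc m) F ⟩
  sumF2 (suc m) (λ x → F (false ∷ x)) ℤ.+ sumF2 (suc m) (λ x → F (true ∷ x))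
    ≡⟨ cong₂ ℤ._+_ (sumF2-∷ m _) (sumF2-∷ m _) ⟩
  (sumF2 m (F ∘ (false ∷_) ∘ (false ∷_)) ℤ.+ sumF2 m (F ∘ (false ∷_) ∘ (true ∷_)))
    ℤ.+ (sumF2 m (F ∘ (true ∷_) ∘ (false ∷_)) ℤ.+ sumF2 m (F ∘ (true ∷_) ∘ (true ∷_)))
    ≡⟨ cong₂ ℤ._+_ (∑-+ (allVecs m) _ _) (∑-+ (allVecs m) _ _) ⟨
  sumF2 m (λ r → F (false ∷ false ∷ r) ℤ.+ F (false ∷ true ∷ r))
    ℤ.+ sumF2 m (λ r → F (true ∷ false ∷ r) ℤ.+ F (true ∷ true ∷ r))
    ≡⟨ ∑-+ (allVecs m) _ _ ⟨
  sumF2 m (λ r → (F (false ∷ false ∷ r) ℤ.+ F (false ∷ true ∷ r)) ℤ.+ (F (true ∷ false ∷ r) ℤ.+ F (true ∷ true ∷ r)))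
    ∎
  where open ≡-Reasoning

-- b enters only through b ∧ (a xor c), so summing over b leaves just the terms with c = a.
sum-over-two-bits : ∀ a (D : Bool → Bool) → let f b c = sgn ((a ∧ b) xor ((b ∧ c) xor D c)) in
  (f false false ℤ.+ f false true) ℤ.+ (f true false ℤ.+ f true true) ≡ + 2 ℤ.* sgn (D a)
sum-over-two-bits false D with D false | D true
... | false | false = refl
... | false | true  = refl
... | true  | false = refl
... | true  | true  = refl
sum-over-two-bits true D with D false | D true
... | false | false = refl
... | false | true  = refl
... | true  | false = refl
... | true  | true  = refl

S-ρ-step : ∀ m → S (3 + m) ρ ≡ + 2 ℤ.* S (1 + m) ρ
S-ρ-step m = begin
  S (3 + m) ρ
    ≡⟨ sumF2-∷ (2 + m) _ ⟩
  sumF2 (2 + m) (Q ∘ (false ∷_)) ℤ.+ sumF2 (2 + m) (Q ∘ (true ∷_))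
    ≡⟨ cong₂ ℤ._+_ (with-first false) (with-first true) ⟩
  + 2 ℤ.* sumF2 m (Q ∘ (false ∷_)) ℤ.+ + 2 ℤ.* sumF2 m (Q ∘ (true ∷_))
    ≡⟨ ℤ.*-distribˡ-+ (+ 2) (sumF2 m (Q ∘ (false ∷_))) _ ⟨
  + 2 ℤ.* (sumF2 m (Q ∘ (false ∷_)) ℤ.+ sumF2 m (Q ∘ (true ∷_)))
    ≡⟨ cong (+ 2 ℤ.*_) (sumF2-∷ m Q) ⟨
  + 2 ℤ.* S (1 + m) ρ
    ∎
  where
  open ≡-Reasoning
  Q : ∀ {n} → Vec Bool n → ℤ
  Q u = sgn (u · ρ u)
  with-first : ∀ a → sumF2 (2 + m) (Q ∘ (a ∷_)) ≡ + 2 ℤ.* sumF2 m (Q ∘ (a ∷_))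
  with-first a = trans (sumF2-2+ m (Q ∘ (a ∷_)))
    (trans (sumF2-cong m (λ r → sum-over-two-bits a (λ c → (c ∷ r) · (r ∷ʳ a))))
           (∑-*ˡ (allVecs m) (Q ∘ (a ∷_)) (+ 2)))

S-ρ-odd : ∀ m → ¬ 2 ∣ m → S m ρ ≡ + 0
S-ρ-odd 0                   2∤m = contradiction (2 ∣0) 2∤m
S-ρ-odd 1                   _   = refl
S-ρ-odd 2                   2∤m = contradiction ∣-refl 2∤m
S-ρ-odd (suc (suc (suc m))) 2∤m =
  trans (S-ρ-step m) (cong (+ 2 ℤ.*_) (S-ρ-odd (suc m) (2∤m ∘ ∣m∣n⇒∣m+n ∣-refl)))

S-ρ-even : ∀ q → S (suc q * 2) ρ ≡ + (2 ^ (q + 2))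
S-ρ-even zero    = refl
S-ρ-even (suc q) = trans (S-ρ-step (suc (q * 2))) (trans (cong (+ 2 ℤ.*_) (S-ρ-even q)) (sym (ℤ.pos-* 2 (2 ^ (q + 2)))))

module _ (m : ℕ) where

  private
    M : ℕ
    M = suc m

  blockForm : ∀ k → Vec Bool (k * M) → Bool
  blockForm k y = ⨁[ r < k ] ⨁[ t < M ] (y ‼ (r * M + t) ∧ y ‼ (r * M + suc t % M))

  ·ρ-as-xorSum : ∀ (u : Vec Bool M) → u · ρ u ≡ ⨁[ t < M ] (u ‼ t ∧ u ‼ (suc t % M))
  ·ρ-as-xorSum u = trans (·-as-xorSum u (ρ u)) (xorSum-cong M (λ t t<M → cong (u ‼ t ∧_)
    (trans (sym (⟪⟫-< (ρ u) t<M)) (⟪⟫-ρ u t))))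

  blockForm-++ : ∀ k (u : Vec Bool M) (v : Vec Bool (k * M)) → blockForm (suc k) (u ++ v) ≡ (u · ρ u) xor blockForm k v
  blockForm-++ k u v = cong₂ _xor_ first-block other-blocks
    where
    first-block : ⨁[ t < M ] ((u ++ v) ‼ t ∧ (u ++ v) ‼ (suc t % M)) ≡ u · ρ u
    first-block = trans (xorSum-cong M (λ t t<M → cong₂ _∧_ (‼-++ˡ u v t<M) (‼-++ˡ u v (m%n<n (suc t) M))))
                        (sym (·ρ-as-xorSum u))
    ‼-shift : ∀ r i → (u ++ v) ‼ (suc r * M + i) ≡ v ‼ (r * M + i)
    ‼-shift r i = trans (cong ((u ++ v) ‼_) (ℕ.+-assoc M (r * M) i)) (‼-++ʳ u v (r * M + i))
    other-blocks : ⨁[ r < k ] ⨁[ t < M ] ((u ++ v) ‼ (suc r * M + t) ∧ (u ++ v) ‼ (suc r * M + suc t % M))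
                   ≡ blockForm k v
    other-blocks = xorSum-cong k (λ r _ → xorSum-cong M (λ t _ → cong₂ _∧_ (‼-shift r t) (‼-shift r (suc t % M))))

  sumF2-blockForm : ∀ k → sumF2 (k * M) (sgn ∘ blockForm k) ≡ S M ρ ℤ.^ k
  sumF2-blockForm zero    = refl
  sumF2-blockForm (suc k) = begin
    sumF2 (M + k * M) (sgn ∘ blockForm (suc k))
      ≡⟨ sumF2-++ M (k * M) _ ⟩
    sumF2 M (λ u → sumF2 (k * M) (λ v → sgn (blockForm (suc k) (u ++ v))))
      ≡⟨ sumF2-cong M (λ u → sumF2-cong (k * M) (λ v → trans (cong sgn (blockForm-++ k u v)) (sgn-xor (u · ρ u) (blockForm k v)))) ⟩
    sumF2 M (λ u → sumF2 (k * M) (λ v → sgn (u · ρ u) ℤ.* sgn (blockForm k v)))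
      ≡⟨ sumF2-cong M (λ u → ∑-*ˡ (allVecs (k * M)) (sgn ∘ blockForm k) (sgn (u · ρ u))) ⟩
    sumF2 M (λ u → sgn (u · ρ u) ℤ.* sumF2 (k * M) (sgn ∘ blockForm k))
      ≡⟨ ∑-*ʳ (allVecs M) (λ u → sgn (u · ρ u)) _ ⟩
    S M ρ ℤ.* sumF2 (k * M) (sgn ∘ blockForm k)
      ≡⟨ cong (S M ρ ℤ.*_) (sumF2-blockForm k) ⟩
    S M ρ ℤ.^ suc k
      ∎
    where open ≡-Reasoning

module Factorisation (k m j : ℕ) where

  private
    K M N : ℕ
    K = suc k
    M = suc m
    N = K * M

  ψ : ℕ → ℕ
  ψ p = p / M + (p % M) * j

  ψ-combine : ∀ r {t} → t < M → ψ (r * M + t) ≡ r + t * j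
  ψ-combine r {t} t<M = cong₂ (λ a b → a + b * j) quotient remainder
    where
    quotient : (r * M + t) / M ≡ r
    quotient = begin
      (r * M + t) / M     ≡⟨ cong (_/ M) (ℕ.+-comm (r * M) t) ⟩
      (t + r * M) / M     ≡⟨ +-distrib-/-∣ʳ t (n∣m*n r) ⟩
      t / M + r * M / M   ≡⟨ cong₂ _+_ (m<n⇒m/n≡0 t<M) (m*n/n≡m r M) ⟩
      r                   ∎
      where open ≡-Reasoning
    remainder : (r * M + t) % M ≡ t
    remainder = trans (%-remove-+ˡ t (n∣m*n r)) (m<n⇒m%n≡m t<M)

  module _ (N∣Mj : N ∣ M * j) (minimal : ∀ t → 0 < t → t < M → ¬ N ∣ t * j) where

    K∣j : K ∣ j
    K∣j = *-cancelʳ-∣ M (subst (N ∣_) (ℕ.*-comm M j) N∣Mj)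

    residue : ∀ {r} t → r < K → (r + t * j) % N % K ≡ r
    residue {r} t r<K = begin
      (r + t * j) % N % K   ≡⟨ m∣n⇒o%n%m≡o%m K N (r + t * j) (m∣m*n M) ⟩
      (r + t * j) % K       ≡⟨ %-remove-+ʳ r (∣n⇒∣m*n t K∣j) ⟩
      r % K                 ≡⟨ m<n⇒m%n≡m r<K ⟩
      r                     ∎
      where open ≡-Reasoning

    step-unique : ∀ r {t t′} → t < M → t′ ≤ t → (r + t * j) % N ≡ (r + t′ * j) % N → t ≡ t′
    step-unique r {t} {t′} t<M t′≤t eq with t ∸ t′ in d≡ | ℕ.m∸n+n≡m t′≤t
    ... | zero  | 0+t′≡t = sym 0+t′≡t
    ... | suc d | d+t′≡t = contradiction N∣dj (minimal (suc d) (s≤s z≤n) d<M)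
      where
      d<M : suc d < M
      d<M = subst (_< M) d≡ (ℕ.≤-<-trans (ℕ.m∸n≤m t t′) t<M)
      N∣dj : N ∣ suc d * j
      N∣dj = m%n≡0⇒n∣m (suc d * j) N (%-cancelˡ-+ (r + t′ * j) (suc d * j) 0 N (begin
        (r + t′ * j + suc d * j) % N   ≡⟨ cong (_% N) (regroup r t′ (suc d) j) ⟩
        (r + (suc d + t′) * j) % N     ≡⟨ cong (λ s → (r + s * j) % N) d+t′≡t ⟩
        (r + t * j) % N                ≡⟨ eq ⟩
        (r + t′ * j) % N               ≡⟨ cong (_% N) (ℕ.+-identityʳ (r + t′ * j)) ⟨
        (r + t′ * j + 0) % N           ∎))
        where
        open ≡-Reasoning
        regroup : ∀ r t′ d j → r + t′ * j + d * j ≡ r + (d + t′) * j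
        regroup = solve-∀

    ψ-injective : ∀ {p p′} → p < N → p′ < N → ψ p % N ≡ ψ p′ % N → p ≡ p′
    ψ-injective {p} {p′} p<N p′<N eq = begin
      p                     ≡⟨ m≡m%n+[m/n]*n p M ⟩
      p % M + p / M * M     ≡⟨ cong₂ (λ t r → t + r * M) t≡t′ r≡r′ ⟩
      p′ % M + p′ / M * M   ≡⟨ m≡m%n+[m/n]*n p′ M ⟨
      p′                    ∎
      where
      open ≡-Reasoning
      r≡r′ : p / M ≡ p′ / M
      r≡r′ = trans (sym (residue (p % M) (m<n*o⇒m/o<n p<N)))
                   (trans (cong (_% K) eq) (residue (p′ % M) (m<n*o⇒m/o<n p′<N)))
      eq′ : (p / M + p % M * j) % N ≡ (p / M + p′ % M * j) % N
      eq′ = trans eq (cong (λ r → (r + p′ % M * j) % N) (sym r≡r′))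
      t≡t′ : p % M ≡ p′ % M
      t≡t′ with ℕ.≤-total (p′ % M) (p % M)
      ... | inj₁ t′≤t = step-unique (p / M) (m%n<n p M) t′≤t eq′
      ... | inj₂ t≤t′ = sym (step-unique (p / M) (m%n<n p′ M) t≤t′ (sym eq′))

    ψ-mod : Fin N → Fin N
    ψ-mod p = ψ (toℕ p) mod N

    toℕ-ψ-mod : ∀ p → toℕ (ψ-mod p) ≡ ψ (toℕ p) % N
    toℕ-ψ-mod p = Fin.toℕ-fromℕ< (m%n<n (ψ (toℕ p)) N)

    π : Permutation′ N
    π = injective⇒permutation ψ-mod λ {p} {p′} eq → Fin.toℕ-injective (ψ-injective (Fin.toℕ<n p) (Fin.toℕ<n p′)
          (trans (sym (toℕ-ψ-mod p)) (trans (cong toℕ eq) (toℕ-ψ-mod p′))))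

    Ψ : Vec Bool N → Vec Bool N
    Ψ = reindex (π ⟨$⟩ʳ_)

    Ψ-‼ : ∀ x {q} → q < N → Ψ x ‼ q ≡ x ⟪ ψ q ⟫
    Ψ-‼ x {q} q<N = begin
      Ψ x ‼ q                        ≡⟨ ‼-tabulate (lookup x ∘ ψ-mod) q<N ⟩
      lookup x (ψ-mod (fromℕ< q<N))  ≡⟨ ‼-toℕ x (ψ-mod (fromℕ< q<N)) ⟨
      x ‼ toℕ (ψ-mod (fromℕ< q<N))   ≡⟨ cong (x ‼_) (toℕ-ψ-mod (fromℕ< q<N)) ⟩
      x ⟪ ψ (toℕ (fromℕ< q<N)) ⟫     ≡⟨ cong (λ i → x ⟪ ψ i ⟫) (Fin.toℕ-fromℕ< q<N) ⟩
      x ⟪ ψ q ⟫                      ∎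
      where open ≡-Reasoning

    %M-vanishes : ∀ r a → (r + a % M * j) % N ≡ (r + a * j) % N
    %M-vanishes r a = begin
      (r + a % M * j) % N                    ≡⟨ %-remove-+ʳ (r + a % M * j) (∣n⇒∣m*n (a / M) N∣Mj) ⟨
      (r + a % M * j + a / M * (M * j)) % N  ≡⟨ cong (_% N) (regroup r (a % M) (a / M) M j) ⟩
      (r + (a % M + a / M * M) * j) % N      ≡⟨ cong (λ b → (r + b * j) % N) (m≡m%n+[m/n]*n a M) ⟨
      (r + a * j) % N                        ∎
      where
      open ≡-Reasoning
      regroup : ∀ r s q M j → r + s * j + q * (M * j) ≡ r + (s + q * M) * j
      regroup = solve-∀

    pairTerm : Vec Bool N → ℕ → Bool
    pairTerm x i = x ⟪ i ⟫ ∧ x ⟪ i + j ⟫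

    ·ρ^j-by-orbits : ∀ x → x · (ρ ^[ j ]) x ≡ ⨁[ r < K ] ⨁[ t < M ] pairTerm x (r + t * j)
    ·ρ^j-by-orbits x = begin
      x · (ρ ^[ j ]) x                                   ≡⟨ ·ρ^-as-xorSum x j ⟩
      xorSum N (pairTerm x)                              ≡⟨ xorSum-permute N π (λ p → ψ p % N) toℕ-ψ-mod (pairTerm x) ⟨
      ⨁[ p < N ] pairTerm x (ψ p % N)                    ≡⟨ xorSum-cong N (λ p _ → pairTerm-% (ψ p)) ⟩
      ⨁[ p < N ] pairTerm x (ψ p)                        ≡⟨ xorSum-* K M (pairTerm x ∘ ψ) ⟩
      ⨁[ r < K ] ⨁[ t < M ] pairTerm x (ψ (r * M + t))   ≡⟨ xorSum-cong K (λ r _ → xorSum-cong M (λ t t<M →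
                                                              cong (pairTerm x) (ψ-combine r t<M))) ⟩
      ⨁[ r < K ] ⨁[ t < M ] pairTerm x (r + t * j)       ∎
      where
      open ≡-Reasoning
      pairTerm-% : ∀ a → pairTerm x (a % N) ≡ pairTerm x a
      pairTerm-% a = cong₂ _∧_ (cong (x ‼_) (m%n%n≡m%n a N)) (cong (x ‼_) ([m%d+n]%d≡[m+n]%d a j N))

    blockForm-Ψ : ∀ x → blockForm m K (Ψ x) ≡ ⨁[ r < K ] ⨁[ t < M ] pairTerm x (r + t * j)
    blockForm-Ψ x = xorSum-cong K λ r r<K → xorSum-cong M λ t t<M → cong₂ _∧_
      (trans (Ψ-‼ x (in-range r<K t<M)) (cong (x ⟪_⟫) (ψ-combine r t<M)))
      (begin
        Ψ x ‼ (r * M + suc t % M)     ≡⟨ Ψ-‼ x (in-range r<K (m%n<n (suc t) M)) ⟩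
        x ⟪ ψ (r * M + suc t % M) ⟫   ≡⟨ cong (x ⟪_⟫) (ψ-combine r (m%n<n (suc t) M)) ⟩
        x ⟪ r + suc t % M * j ⟫       ≡⟨ cong (x ‼_) (%M-vanishes r (suc t)) ⟩
        x ⟪ r + suc t * j ⟫           ≡⟨ cong (x ⟪_⟫) (regroup r t j) ⟩
        x ⟪ r + t * j + j ⟫           ∎)
      where
      open ≡-Reasoning
      in-range : ∀ {r t} → r < K → t < M → r * M + t < N
      in-range {r} r<K t<M = ℕ.<-≤-trans (ℕ.+-monoʳ-< (r * M) t<M)
        (subst (_≤ N) (ℕ.+-comm M (r * M)) (ℕ.*-monoˡ-≤ M r<K))
      regroup : ∀ r t j → r + suc t * j ≡ r + t * j + j
      regroup = solve-∀

    S-ρ^j : S N (ρ ^[ j ]) ≡ S M ρ ℤ.^ K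
    S-ρ^j = begin
      S N (ρ ^[ j ])                  ≡⟨ sumF2-cong N (λ x → cong sgn (trans (·ρ^j-by-orbits x) (sym (blockForm-Ψ x)))) ⟩
      sumF2 N (sgn ∘ blockForm m K ∘ Ψ) ≡⟨ sumF2-reindex N π (sgn ∘ blockForm m K) ⟩
      sumF2 N (sgn ∘ blockForm m K)   ≡⟨ sumF2-blockForm m K ⟩
      S M ρ ℤ.^ K                     ∎
      where open ≡-Reasoning

S-ρ^-factorises : ∀ k m j → IsOrder (ρ {k * m} ^[ j ]) m → S (k * m) (ρ ^[ j ]) ≡ S m ρ ℤ.^ k
S-ρ^-factorises zero    m       j _ with (ρ ^[ j ]) []
... | [] = refl
S-ρ^-factorises (suc k) zero    j (() , _)
S-ρ^-factorises (suc k) (suc m) j (_ , order-id , below-order-not-id) = Factorisation.S-ρ^j k m j N∣Mj minimal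
  where
  N∣Mj : suc k * suc m ∣ suc m * j
  N∣Mj = ρ^-id⇒∣ (suc m * j) (λ x → trans (sym (^[]-* ρ j (suc m) x)) (order-id x))
  minimal : ∀ t → 0 < t → t < suc m → ¬ suc k * suc m ∣ t * j
  minimal t 0<t t<M N∣tj = below-order-not-id t 0<t t<M (λ x → trans (^[]-* ρ j t x) (∣⇒ρ^-id (t * j) N∣tj x))

pos-^ : ∀ a k → + (a ^ k) ≡ (+ a) ℤ.^ k
pos-^ a zero    = refl
pos-^ a (suc k) = trans (ℤ.pos-* a (a ^ k)) (cong (+ a ℤ.*_) (pos-^ a k))

S-ρ-even^ : ∀ k q → S (suc q * 2) ρ ℤ.^ k ≡ + (2 ^ (k * (suc q * 2) / 2 + k))
S-ρ-even^ k q = begin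
  S (suc q * 2) ρ ℤ.^ k              ≡⟨ cong (ℤ._^ k) (S-ρ-even q) ⟩
  (+ (2 ^ (q + 2))) ℤ.^ k            ≡⟨ pos-^ (2 ^ (q + 2)) k ⟨
  + ((2 ^ (q + 2)) ^ k)              ≡⟨ cong +_ (ℕ.^-*-assoc 2 (q + 2) k) ⟩
  + (2 ^ ((q + 2) * k))              ≡⟨ cong (λ e → + (2 ^ e)) exponent ⟩
  + (2 ^ (k * (suc q * 2) / 2 + k))  ∎
  where
  open ≡-Reasoning
  regroup : ∀ q k → (q + 2) * k ≡ k * suc q + k
  regroup = solve-∀
  reassoc : ∀ k q → k * (suc q * 2) ≡ k * suc q * 2
  reassoc = solve-∀
  exponent : (q + 2) * k ≡ k * (suc q * 2) / 2 + k
  exponent = trans (regroup q k) (cong (_+ k) (sym (trans (cong (_/ 2) (reassoc k q)) (m*n/n≡m (k * suc q) 2))))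

lemma2 : (n : ℕ) → 2 < n → (j m k : ℕ) → IsOrder (ρ {n} ^[ j ]) m → 0 < k → k * m ≡ n →
    ((2 ∣ m) → S n (ρ ^[ j ]) ≡ + (2 ^ (n / 2 + k))) × (¬ (2 ∣ m) → S n (ρ ^[ j ]) ≡ + 0)
lemma2 _ _ j m (suc k) order _ refl = even , odd
  where
  factorised : S (suc k * m) (ρ ^[ j ]) ≡ S m ρ ℤ.^ suc k
  factorised = S-ρ^-factorises (suc k) m j order
  even : 2 ∣ m → S (suc k * m) (ρ ^[ j ]) ≡ + (2 ^ (suc k * m / 2 + suc k))
  even (divides zero    m≡0)   = contradiction (subst (0 <_) m≡0 (proj₁ order)) λ ()
  even (divides (suc q) m≡q*2) = trans factorised
    (subst (λ m → S m ρ ℤ.^ suc k ≡ + (2 ^ (suc k * m / 2 + suc k))) (sym m≡q*2) (S-ρ-even^ (suc k) q))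
  odd : ¬ 2 ∣ m → S (suc k * m) (ρ ^[ j ]) ≡ + 0
  odd 2∤m = trans factorised (trans (cong (ℤ._^ suc k) (S-ρ-odd m 2∤m)) (ℤ.*-zeroˡ ((+ 0) ℤ.^ k)))
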